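{- For every binary tree $T$, the polynomial $\mathcal B_T(x)$ equals $\sum_{T'\le T} x^{\lambda(T')}$, where the sum runs over binary trees $T'$ (of the same size as $T$) with $T'\le T$ in the Tamari order and $\lambda(T')$ is the number of nodes on the left branch of $T'$; in particular $\mathcal B_T(1)$ is the number of trees $T'\le T$. Symmetrically, $\tilde{\mathcal B}_T(x)=\sum_{T'\ge T}x^{\rho(T')}$, where $\rho(T')$ is the number of nodes on the right branch of $T'$.
   Context: A binary tree is either empty or a root node with an ordered pair (left subtree, right subtree) of binary trees; its size is its number of nodes. The left (resp. right) branch of a nonempty tree is the sequence of nodes obtained from the root by repeatedly going to the left (resp. right) child. A right rotation replaces a subtree of the form $y(x(A,B),C)$ (node $y$ whose left child is $x$; $A,B,C$ possibly empty) by $x(A,y(B,C))$. The Tamari order on binary trees of size $n$: $T\le T'$ iff $T'$ is obtained from $T$ by a finite sequence of right rotations. Define $\mathcal B_\emptyset=1$ and, for $T$ with left subtree $L$ and right subtree $R$, $$\mathcal B_T(x)=x\,\mathcal B_L(x)\,\frac{x\,\mathcal B_R(x)-\mathcal B_R(1)}{x-1}.$$ Define $\tilde{\mathcal B}_\emptyset=1$ and $\tilde{\mathcal B}_T(x)=x\,\tilde{\mathcal B}_R(x)\,\frac{x\,\tilde{\mathcal B}_L(x)-\tilde{\mathcal B}_L(1)}{x-1}$ (roles of the left and right subtrees exchanged). -}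

module Defs where

open import Data.Nat using (ℕ; zero; suc; _+_; _*_)
open import Data.List using (List; []; _∷_; map; foldr)
open import Data.Nat.ListAction using (sum)
open import Relation.Binary.PropositionalEquality using (_≡_)
open import Relation.Binary.Construct.Closure.ReflexiveTransitive using (Star)

data Tree : Set where
  leaf : Tree
  node : Tree → Tree → Tree

size : Tree → ℕ
size leaf       = 0
size (node l r) = suc (size l + size r)

leftBranch : Tree → ℕ
leftBranch leaf       = 0
leftBranch (node l r) = suc (leftBranch l)

rightBranch : Tree → ℕ
rightBranch leaf       = 0
rightBranch (node l r) = suc (rightBranch r)

data _⟶_ : Tree → Tree → Set where
  rot   : ∀ A B C → node (node A B) C ⟶ node A (node B C)
  left  : ∀ {L L′} R → L ⟶ L′ → node L R ⟶ node L′ R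
  right : ∀ L {R R′} → R ⟶ R′ → node L R ⟶ node L R′

_≤T_ : Tree → Tree → Set
_≤T_ = Star _⟶_

-- Polynomials with natural-number coefficients, as coefficient lists
-- (constant term first).  Equality of polynomials is coefficientwise.

Poly : Set
Poly = List ℕ

coeff : Poly → ℕ → ℕ
coeff []       _       = 0
coeff (c ∷ cs) zero    = c
coeff (c ∷ cs) (suc k) = coeff cs k

_≈ₚ_ : Poly → Poly → Set
p ≈ₚ q = ∀ k → coeff p k ≡ coeff q k

infix 4 _≈ₚ_

_+ₚ_ : Poly → Poly → Poly
[]       +ₚ q        = q
(c ∷ cs) +ₚ []       = c ∷ cs
(c ∷ cs) +ₚ (d ∷ ds) = (c + d) ∷ (cs +ₚ ds)

scale : ℕ → Poly → Poly
scale a = map (a *_)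

_*ₚ_ : Poly → Poly → Poly
[]       *ₚ q = []
(c ∷ cs) *ₚ q = scale c q +ₚ (0 ∷ (cs *ₚ q))

xₚ : Poly → Poly
xₚ p = 0 ∷ p

one : Poly
one = 1 ∷ []

mono : ℕ → Poly
mono zero    = one
mono (suc k) = xₚ (mono k)

at1 : Poly → ℕ
at1 = sum

-- divDiff P = (x P(x) - P(1)) / (x - 1), the exact polynomial quotient.
-- Writing P = c + x P', one has x P - P(1) = (x-1)(c + P'(1)) + x (x P' - P'(1)),
-- hence the quotient is (c + P'(1)) + x · divDiff P'.
divDiff : Poly → Poly
divDiff []       = []
divDiff (c ∷ cs) = (c + at1 cs) ∷ divDiff cs

𝓑 : Tree → Poly
𝓑 leaf       = one
𝓑 (node l r) = xₚ (𝓑 l *ₚ divDiff (𝓑 r))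

𝓑̃ : Tree → Poly
𝓑̃ leaf       = one
𝓑̃ (node l r) = xₚ (𝓑̃ r *ₚ divDiff (𝓑̃ l))

sumMono : (Tree → ℕ) → List Tree → Poly
sumMono f = foldr (λ t acc → mono (f t) +ₚ acc) []

-- The trees below node l r in the Tamari order are exactly the trees obtained by grafting some
-- s ≤ l onto the left branch of some t ≤ r, each such tree arising from a unique pair (s, t).
-- Grafting s onto the left branch of t at its 1 + λ(t) possible places produces left branches of
-- lengths λ(s) + 1, …, λ(s) + λ(t) + 1, i.e. the polynomial x · x^λ(s) · (x · x^λ(t) − 1)/(x − 1).
-- Summing over s and t, the generating polynomial of the interval below node l r is therefore
-- x · B_l(x) · (x B_r(x) − B_r(1))/(x − 1), which is the recursion defining B.  Mirroring trees
-- reverses rotations and exchanges left and right branches, which gives the statement for B̃.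
module Submission where

open import Defs
open import Data.Empty using (⊥-elim)
open import Data.List using (List; []; _∷_; _++_; map; foldr; concatMap; length)
open import Data.List.Membership.Propositional using (_∈_; find; lose)
open import Data.List.Membership.Propositional.Properties using (∈-map⁺; ∈-map⁻; ∈-concatMap⁺; ∈-concatMap⁻)
open import Data.List.Relation.Binary.Disjoint.Propositional using (Disjoint)
open import Data.List.Relation.Unary.All as All using ()
open import Data.List.Relation.Unary.AllPairs using ([]; _∷_)
open import Data.List.Relation.Unary.Any using (here; there)
open import Data.List.Relation.Unary.Unique.Propositional using (Unique)
import Data.List.Relation.Unary.Unique.Propositional.Properties as Unique
open import Data.Nat using (ℕ; zero; suc; _+_; _*_)
open import Data.Nat.Properties
  using (+-assoc; +-suc; +-identityʳ; *-zeroʳ; *-identityʳ; *-distribˡ-+; *-distribʳ-+; m≢1+m+n; +-commutativeSemigroup)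
open import Algebra.Properties.CommutativeSemigroup +-commutativeSemigroup
  using () renaming (interchange to +-interchange)
open import Data.Product using (Σ; ∃₂; _×_; _,_; proj₁; proj₂)
open import Function.Base using (_∘_)
open import Function.Bundles using (_⇔_; mk⇔)
open import Relation.Binary.Bundles using (Setoid)
open import Relation.Binary.Construct.Closure.ReflexiveTransitive using (ε; _◅_; _◅◅_; gmap; fold; return)
open import Relation.Binary.PropositionalEquality
import Relation.Binary.Reasoning.Setoid as SetoidReasoning

infix 4 _≋_

-- _≈ₚ_ wrapped in a record so that both polynomials can be inferred from a proof of it.
record _≋_ (p q : Poly) : Set where
  constructor mk≋
  field coeff-≡ : p ≈ₚ q
open _≋_

≋-refl : ∀ {p} → p ≋ p
≋-refl = mk≋ λ _ → refl

≋-reflexive : ∀ {p q} → p ≡ q → p ≋ q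
≋-reflexive refl = ≋-refl

≋-sym : ∀ {p q} → p ≋ q → q ≋ p
≋-sym (mk≋ e) = mk≋ λ k → sym (e k)

≋-trans : ∀ {p q r} → p ≋ q → q ≋ r → p ≋ r
≋-trans (mk≋ e) (mk≋ f) = mk≋ λ k → trans (e k) (f k)

≋-setoid : Setoid _ _
≋-setoid = record
  { Carrier = Poly
  ; _≈_ = _≋_
  ; isEquivalence = record { refl = ≋-refl ; sym = ≋-sym ; trans = ≋-trans }
  }

module ≋-Reasoning = SetoidReasoning ≋-setoid

-- With coeff [] 0 = 0 and tailₚ [] = [], the empty list behaves as 0 ∷ [], so the two lemmas
-- below also cover comparisons with trailing zeros.
tailₚ : Poly → Poly
tailₚ []      = []
tailₚ (_ ∷ p) = p

∷-≋⁺ : ∀ {c p q} → c ≡ coeff q 0 → p ≋ tailₚ q → c ∷ p ≋ q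
∷-≋⁺ {q = []}    c≡ (mk≋ e) = mk≋ λ { zero → c≡ ; (suc k) → e k }
∷-≋⁺ {q = _ ∷ _} c≡ (mk≋ e) = mk≋ λ { zero → c≡ ; (suc k) → e k }

∷-≋⁻ : ∀ {c p q} → c ∷ p ≋ q → c ≡ coeff q 0 × p ≋ tailₚ q
∷-≋⁻ {q = []}    (mk≋ e) = e 0 , mk≋ (e ∘ suc)
∷-≋⁻ {q = _ ∷ _} (mk≋ e) = e 0 , mk≋ (e ∘ suc)

xₚ-cong : ∀ {p q} → p ≋ q → xₚ p ≋ xₚ q
xₚ-cong = ∷-≋⁺ refl

xₚ-zero : xₚ [] ≋ []
xₚ-zero = ∷-≋⁺ refl ≋-refl

coeff-+ₚ : ∀ p q k → coeff (p +ₚ q) k ≡ coeff p k + coeff q k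
coeff-+ₚ []       q        k       = refl
coeff-+ₚ (c ∷ p)  []       k       = sym (+-identityʳ _)
coeff-+ₚ (c ∷ p)  (d ∷ q)  zero    = refl
coeff-+ₚ (c ∷ p)  (d ∷ q)  (suc k) = coeff-+ₚ p q k

coeff-scale : ∀ a p k → coeff (scale a p) k ≡ a * coeff p k
coeff-scale a []      k       = sym (*-zeroʳ a)
coeff-scale a (c ∷ p) zero    = refl
coeff-scale a (c ∷ p) (suc k) = coeff-scale a p k

+ₚ-cong : ∀ {p p′ q q′} → p ≋ p′ → q ≋ q′ → p +ₚ q ≋ p′ +ₚ q′
+ₚ-cong {p} {p′} {q} {q′} (mk≋ e) (mk≋ f) = mk≋ λ k → begin
  coeff (p +ₚ q) k         ≡⟨ coeff-+ₚ p q k ⟩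
  coeff p k + coeff q k    ≡⟨ cong₂ _+_ (e k) (f k) ⟩
  coeff p′ k + coeff q′ k  ≡⟨ coeff-+ₚ p′ q′ k ⟨
  coeff (p′ +ₚ q′) k       ∎
  where open ≡-Reasoning

+ₚ-identityʳ : ∀ p → p +ₚ [] ≋ p
+ₚ-identityʳ []      = ≋-refl
+ₚ-identityʳ (_ ∷ _) = ≋-refl

+ₚ-assoc : ∀ p q r → (p +ₚ q) +ₚ r ≋ p +ₚ (q +ₚ r)
+ₚ-assoc p q r = mk≋ λ k → begin
  coeff ((p +ₚ q) +ₚ r) k                ≡⟨ coeff-+ₚ (p +ₚ q) r k ⟩
  coeff (p +ₚ q) k + coeff r k           ≡⟨ cong (_+ coeff r k) (coeff-+ₚ p q k) ⟩
  coeff p k + coeff q k + coeff r k      ≡⟨ +-assoc (coeff p k) _ _ ⟩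
  coeff p k + (coeff q k + coeff r k)    ≡⟨ cong (coeff p k +_) (coeff-+ₚ q r k) ⟨
  coeff p k + coeff (q +ₚ r) k           ≡⟨ coeff-+ₚ p (q +ₚ r) k ⟨
  coeff (p +ₚ (q +ₚ r)) k                ∎
  where open ≡-Reasoning

+ₚ-interchange : ∀ p q r s → (p +ₚ q) +ₚ (r +ₚ s) ≋ (p +ₚ r) +ₚ (q +ₚ s)
+ₚ-interchange p q r s = mk≋ λ k → begin
  coeff ((p +ₚ q) +ₚ (r +ₚ s)) k                            ≡⟨ expand p q r s k ⟩
  (coeff p k + coeff q k) + (coeff r k + coeff s k)          ≡⟨ +-interchange (coeff p k) (coeff q k) (coeff r k) (coeff s k) ⟩
  (coeff p k + coeff r k) + (coeff q k + coeff s k)          ≡⟨ expand p r q s k ⟨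
  coeff ((p +ₚ r) +ₚ (q +ₚ s)) k                            ∎
  where
  open ≡-Reasoning
  expand : ∀ p q r s k → coeff ((p +ₚ q) +ₚ (r +ₚ s)) k ≡ (coeff p k + coeff q k) + (coeff r k + coeff s k)
  expand p q r s k = trans (coeff-+ₚ (p +ₚ q) (r +ₚ s) k) (cong₂ _+_ (coeff-+ₚ p q k) (coeff-+ₚ r s k))

scale-congˡ : ∀ a {p q} → p ≋ q → scale a p ≋ scale a q
scale-congˡ a {p} {q} (mk≋ e) = mk≋ λ k →
  trans (coeff-scale a p k) (trans (cong (a *_) (e k)) (sym (coeff-scale a q k)))

scale-zero : ∀ p → scale 0 p ≋ []
scale-zero p = mk≋ (coeff-scale 0 p)

scale-distrib : ∀ a p q → scale a (p +ₚ q) ≋ scale a p +ₚ scale a q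
scale-distrib a p q = mk≋ λ k → begin
  coeff (scale a (p +ₚ q)) k                ≡⟨ coeff-scale a (p +ₚ q) k ⟩
  a * coeff (p +ₚ q) k                      ≡⟨ cong (a *_) (coeff-+ₚ p q k) ⟩
  a * (coeff p k + coeff q k)               ≡⟨ *-distribˡ-+ a (coeff p k) (coeff q k) ⟩
  a * coeff p k + a * coeff q k             ≡⟨ cong₂ _+_ (coeff-scale a p k) (coeff-scale a q k) ⟨
  coeff (scale a p) k + coeff (scale a q) k ≡⟨ coeff-+ₚ (scale a p) (scale a q) k ⟨
  coeff (scale a p +ₚ scale a q) k          ∎
  where open ≡-Reasoning

scale-distribʳ : ∀ a b p → scale (a + b) p ≋ scale a p +ₚ scale b p
scale-distribʳ a b p = mk≋ λ k → begin
  coeff (scale (a + b) p) k                 ≡⟨ coeff-scale (a + b) p k ⟩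
  (a + b) * coeff p k                       ≡⟨ *-distribʳ-+ (coeff p k) a b ⟩
  a * coeff p k + b * coeff p k             ≡⟨ cong₂ _+_ (coeff-scale a p k) (coeff-scale b p k) ⟨
  coeff (scale a p) k + coeff (scale b p) k ≡⟨ coeff-+ₚ (scale a p) (scale b p) k ⟨
  coeff (scale a p +ₚ scale b p) k          ∎
  where open ≡-Reasoning

*ₚ-zeroˡ : ∀ {p} q → p ≋ [] → p *ₚ q ≋ []
*ₚ-zeroˡ {[]}    q _   = ≋-refl
*ₚ-zeroˡ {c ∷ p} q c∷p≋[] with refl , p≋[] ← ∷-≋⁻ c∷p≋[] = begin
  scale 0 q +ₚ xₚ (p *ₚ q)  ≈⟨ +ₚ-cong (scale-zero q) (xₚ-cong (*ₚ-zeroˡ q p≋[])) ⟩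
  [] +ₚ xₚ []               ≈⟨ xₚ-zero ⟩
  []                        ∎
  where open ≋-Reasoning

*ₚ-zeroʳ : ∀ p → p *ₚ [] ≋ []
*ₚ-zeroʳ []      = ≋-refl
*ₚ-zeroʳ (c ∷ p) = ∷-≋⁺ refl (*ₚ-zeroʳ p)

*ₚ-congʳ : ∀ q {p p′} → p ≋ p′ → p *ₚ q ≋ p′ *ₚ q
*ₚ-congʳ q {[]}    {[]}     _  = ≋-refl
*ₚ-congʳ q {[]}    {_ ∷ _}  e  = ≋-sym (*ₚ-zeroˡ q (≋-sym e))
*ₚ-congʳ q {_ ∷ _} {[]}     e  = *ₚ-zeroˡ q e
*ₚ-congʳ q {c ∷ p} {d ∷ p′} e with refl , p≋p′ ← ∷-≋⁻ e =
  +ₚ-cong ≋-refl (xₚ-cong (*ₚ-congʳ q p≋p′))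

*ₚ-congˡ : ∀ p {q q′} → q ≋ q′ → p *ₚ q ≋ p *ₚ q′
*ₚ-congˡ []      e = ≋-refl
*ₚ-congˡ (c ∷ p) e = +ₚ-cong (scale-congˡ c e) (xₚ-cong (*ₚ-congˡ p e))

*ₚ-distribˡ : ∀ p q r → p *ₚ (q +ₚ r) ≋ (p *ₚ q) +ₚ (p *ₚ r)
*ₚ-distribˡ []      q r = ≋-refl
*ₚ-distribˡ (c ∷ p) q r = begin
  scale c (q +ₚ r) +ₚ xₚ (p *ₚ (q +ₚ r))
    ≈⟨ +ₚ-cong (scale-distrib c q r) (xₚ-cong (*ₚ-distribˡ p q r)) ⟩
  (scale c q +ₚ scale c r) +ₚ (xₚ (p *ₚ q) +ₚ xₚ (p *ₚ r))
    ≈⟨ +ₚ-interchange (scale c q) (scale c r) _ _ ⟩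
  ((c ∷ p) *ₚ q) +ₚ ((c ∷ p) *ₚ r)
    ∎
  where open ≋-Reasoning

*ₚ-distribʳ : ∀ r p q → (p +ₚ q) *ₚ r ≋ (p *ₚ r) +ₚ (q *ₚ r)
*ₚ-distribʳ r []      q       = ≋-refl
*ₚ-distribʳ r (c ∷ p) []      = ≋-sym (+ₚ-identityʳ _)
*ₚ-distribʳ r (c ∷ p) (d ∷ q) = begin
  scale (c + d) r +ₚ xₚ ((p +ₚ q) *ₚ r)
    ≈⟨ +ₚ-cong (scale-distribʳ c d r) (xₚ-cong (*ₚ-distribʳ r p q)) ⟩
  (scale c r +ₚ scale d r) +ₚ (xₚ (p *ₚ r) +ₚ xₚ (q *ₚ r))
    ≈⟨ +ₚ-interchange (scale c r) (scale d r) _ _ ⟩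
  ((c ∷ p) *ₚ r) +ₚ ((d ∷ q) *ₚ r)
    ∎
  where open ≋-Reasoning

*ₚ-identityʳ : ∀ p → p *ₚ one ≋ p
*ₚ-identityʳ []      = ≋-refl
*ₚ-identityʳ (c ∷ p) = ∷-≋⁺ (trans (+-identityʳ _) (*-identityʳ c)) (*ₚ-identityʳ p)

*ₚ-xₚ : ∀ p q → p *ₚ xₚ q ≋ xₚ (p *ₚ q)
*ₚ-xₚ []      q = ≋-sym xₚ-zero
*ₚ-xₚ (c ∷ p) q = ∷-≋⁺ (trans (+-identityʳ _) (*-zeroʳ c)) (+ₚ-cong ≋-refl (*ₚ-xₚ p q))

at1-+ₚ : ∀ p q → at1 (p +ₚ q) ≡ at1 p + at1 q
at1-+ₚ []      q       = refl
at1-+ₚ (c ∷ p) []      = sym (+-identityʳ _)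
at1-+ₚ (c ∷ p) (d ∷ q) = trans (cong (c + d +_) (at1-+ₚ p q)) (+-interchange c d _ _)

at1-zero : ∀ {p} → p ≋ [] → at1 p ≡ 0
at1-zero {[]}    _ = refl
at1-zero {c ∷ p} e with refl , p≋[] ← ∷-≋⁻ e = at1-zero p≋[]

at1-cong : ∀ {p q} → p ≋ q → at1 p ≡ at1 q
at1-cong {[]}    {_}      e = sym (at1-zero (≋-sym e))
at1-cong {_ ∷ _} {[]}     e = at1-zero e
at1-cong {c ∷ p} {d ∷ q}  e with refl , p≋q ← ∷-≋⁻ e = cong (c +_) (at1-cong p≋q)

at1-mono : ∀ k → at1 (mono k) ≡ 1
at1-mono zero    = refl
at1-mono (suc k) = at1-mono k

divDiff-zero : ∀ {p} → p ≋ [] → divDiff p ≋ []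
divDiff-zero {[]}    _ = ≋-refl
divDiff-zero {c ∷ p} e with refl , p≋[] ← ∷-≋⁻ e = ∷-≋⁺ (at1-zero p≋[]) (divDiff-zero p≋[])

divDiff-cong : ∀ {p q} → p ≋ q → divDiff p ≋ divDiff q
divDiff-cong {[]}    {_}      e = ≋-sym (divDiff-zero (≋-sym e))
divDiff-cong {_ ∷ _} {[]}     e = divDiff-zero e
divDiff-cong {c ∷ p} {d ∷ q}  e with refl , p≋q ← ∷-≋⁻ e =
  ∷-≋⁺ (cong (c +_) (at1-cong p≋q)) (divDiff-cong p≋q)

divDiff-+ₚ : ∀ p q → divDiff (p +ₚ q) ≋ divDiff p +ₚ divDiff q
divDiff-+ₚ []      q       = ≋-refl
divDiff-+ₚ (c ∷ p) []      = ≋-sym (+ₚ-identityʳ _)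
divDiff-+ₚ (c ∷ p) (d ∷ q) =
  ∷-≋⁺ (trans (cong (c + d +_) (at1-+ₚ p q)) (+-interchange c d _ _))
       (divDiff-+ₚ p q)

divDiff-mono : ∀ b → divDiff (mono (suc b)) ≡ one +ₚ xₚ (divDiff (mono b))
divDiff-mono b = cong (_∷ divDiff (mono b)) (at1-mono b)

private variable A B : Set

sumₚ : (A → Poly) → List A → Poly
sumₚ f = foldr (λ a acc → f a +ₚ acc) []

sumₚ-cong : ∀ {f g : A → Poly} xs → (∀ a → f a ≋ g a) → sumₚ f xs ≋ sumₚ g xs
sumₚ-cong []       e = ≋-refl
sumₚ-cong (x ∷ xs) e = +ₚ-cong (e x) (sumₚ-cong xs e)

sumₚ-map : ∀ (f : B → Poly) (g : A → B) xs → sumₚ f (map g xs) ≡ sumₚ (f ∘ g) xs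
sumₚ-map f g []       = refl
sumₚ-map f g (x ∷ xs) = cong (f (g x) +ₚ_) (sumₚ-map f g xs)

sumₚ-++ : ∀ (f : A → Poly) xs ys → sumₚ f (xs ++ ys) ≋ sumₚ f xs +ₚ sumₚ f ys
sumₚ-++ f []       ys = ≋-refl
sumₚ-++ f (x ∷ xs) ys =
  ≋-trans (+ₚ-cong ≋-refl (sumₚ-++ f xs ys)) (≋-sym (+ₚ-assoc (f x) (sumₚ f xs) (sumₚ f ys)))

sumₚ-concatMap : ∀ (f : B → Poly) (g : A → List B) xs →
                 sumₚ f (concatMap g xs) ≋ sumₚ (sumₚ f ∘ g) xs
sumₚ-concatMap f g []       = ≋-refl
sumₚ-concatMap f g (x ∷ xs) =
  ≋-trans (sumₚ-++ f (g x) (concatMap g xs)) (+ₚ-cong ≋-refl (sumₚ-concatMap f g xs))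

xₚ-sumₚ : ∀ (f : A → Poly) xs → xₚ (sumₚ f xs) ≋ sumₚ (xₚ ∘ f) xs
xₚ-sumₚ f []       = xₚ-zero
xₚ-sumₚ f (x ∷ xs) = +ₚ-cong {xₚ (f x)} ≋-refl (xₚ-sumₚ f xs)

divDiff-sumₚ : ∀ (f : A → Poly) xs → divDiff (sumₚ f xs) ≋ sumₚ (divDiff ∘ f) xs
divDiff-sumₚ f []       = ≋-refl
divDiff-sumₚ f (x ∷ xs) = ≋-trans (divDiff-+ₚ (f x) (sumₚ f xs)) (+ₚ-cong ≋-refl (divDiff-sumₚ f xs))

sumₚ-*ₚʳ : ∀ (f : A → Poly) xs q → sumₚ f xs *ₚ q ≋ sumₚ (λ a → f a *ₚ q) xs
sumₚ-*ₚʳ f []       q = ≋-refl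
sumₚ-*ₚʳ f (x ∷ xs) q = ≋-trans (*ₚ-distribʳ q (f x) (sumₚ f xs)) (+ₚ-cong ≋-refl (sumₚ-*ₚʳ f xs q))

sumₚ-*ₚˡ : ∀ p (f : A → Poly) xs → p *ₚ sumₚ f xs ≋ sumₚ (λ a → p *ₚ f a) xs
sumₚ-*ₚˡ p f []       = *ₚ-zeroʳ p
sumₚ-*ₚˡ p f (x ∷ xs) = ≋-trans (*ₚ-distribˡ p (f x) (sumₚ f xs)) (+ₚ-cong ≋-refl (sumₚ-*ₚˡ p f xs))

sumₚ-*ₚ-sumₚ : ∀ (f : A → Poly) (g : B → Poly) xs ys →
               sumₚ f xs *ₚ sumₚ g ys ≋ sumₚ (λ a → sumₚ (λ b → f a *ₚ g b) ys) xs
sumₚ-*ₚ-sumₚ f g xs ys =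
  ≋-trans (sumₚ-*ₚʳ f xs (sumₚ g ys)) (sumₚ-cong xs λ a → sumₚ-*ₚˡ (f a) g ys)

at1-sumMono : ∀ (f : A → ℕ) xs → at1 (sumₚ (mono ∘ f) xs) ≡ length xs
at1-sumMono f []       = refl
at1-sumMono f (x ∷ xs) = begin
  at1 (mono (f x) +ₚ sumₚ (mono ∘ f) xs)       ≡⟨ at1-+ₚ (mono (f x)) _ ⟩
  at1 (mono (f x)) + at1 (sumₚ (mono ∘ f) xs)  ≡⟨ cong₂ _+_ (at1-mono (f x)) (at1-sumMono f xs) ⟩
  suc (length xs)                              ∎
  where open ≡-Reasoning

concatMap-unique : (g : A → List B) {xs : List A} → Unique xs → (∀ a → Unique (g a)) →
                   (∀ {a b y} → a ∈ xs → b ∈ xs → y ∈ g a → y ∈ g b → a ≡ b) →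
                   Unique (concatMap g xs)
concatMap-unique g {[]}     _            _       _        = []
concatMap-unique g {a ∷ as} (a∉as ∷ as!) unique! separate =
  Unique.++⁺ (unique! a) (concatMap-unique g as! unique! λ a∈ b∈ → separate (there a∈) (there b∈)) disjoint
  where
  disjoint : Disjoint (g a) (concatMap g as)
  disjoint (y∈ga , y∈gas) with b , b∈as , y∈gb ← find (∈-concatMap⁻ g y∈gas) =
    All.lookup a∉as b∈as (separate (here refl) (there b∈as) y∈ga y∈gb)

size-⟶ : ∀ {X Y} → X ⟶ Y → size X ≡ size Y
size-⟶ (rot A B C) = cong suc (begin
  suc (size A + size B) + size C    ≡⟨ cong suc (+-assoc (size A) (size B) (size C)) ⟩
  suc (size A + (size B + size C))  ≡⟨ +-suc (size A) _ ⟨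
  size A + suc (size B + size C)    ∎)
  where open ≡-Reasoning
size-⟶ (left R L⟶L′)  = cong (λ n → suc (n + size R)) (size-⟶ L⟶L′)
size-⟶ (right L R⟶R′) = cong (λ n → suc (size L + n)) (size-⟶ R⟶R′)

size-≤T : ∀ {X Y} → X ≤T Y → size X ≡ size Y
size-≤T = fold (λ X Y → size X ≡ size Y) (trans ∘ size-⟶) refl

size≡0⇒leaf : ∀ {X} → size X ≡ 0 → X ≡ leaf
size≡0⇒leaf {leaf} _ = refl

node-monoˡ : ∀ {L L′} R → L ≤T L′ → node L R ≤T node L′ R
node-monoˡ R = gmap (λ L → node L R) (left R)

node-monoʳ : ∀ L {R R′} → R ≤T R′ → node L R ≤T node L R′
node-monoʳ L = gmap (node L) (right L)

data Graft (s : Tree) : Tree → Tree → Set where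
  atRoot : ∀ {t} → Graft s t (node s t)
  inLeft : ∀ {t₁ t₂ X} → Graft s t₁ X → Graft s (node t₁ t₂) (node X t₂)

grafts : Tree → Tree → List Tree
grafts s leaf           = node s leaf ∷ []
grafts s (node t₁ t₂)   = node s (node t₁ t₂) ∷ map (λ X → node X t₂) (grafts s t₁)

∈-grafts⁺ : ∀ {s t X} → Graft s t X → X ∈ grafts s t
∈-grafts⁺ {t = leaf}     atRoot     = here refl
∈-grafts⁺ {t = node _ _} atRoot     = here refl
∈-grafts⁺                (inLeft g) = there (∈-map⁺ _ (∈-grafts⁺ g))

∈-grafts⁻ : ∀ s t {X} → X ∈ grafts s t → Graft s t X
∈-grafts⁻ s leaf         (here refl) = atRoot
∈-grafts⁻ s (node t₁ t₂) (here refl) = atRoot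
∈-grafts⁻ s (node t₁ t₂) (there X∈) with Y , Y∈ , refl ← ∈-map⁻ (λ X → node X t₂) X∈ =
  inLeft (∈-grafts⁻ s t₁ Y∈)

Graft-≤T : ∀ {s t X} → Graft s t X → X ≤T node s t
Graft-≤T atRoot                       = ε
Graft-≤T {s} (inLeft {t₁} {t₂} g) = node-monoˡ t₂ (Graft-≤T g) ◅◅ return (rot s t₁ t₂)

Graft-injective : ∀ {s t s′ t′ X} → Graft s t X → Graft s′ t′ X → size s ≡ size s′ → s ≡ s′ × t ≡ t′
Graft-injective atRoot     atRoot     _ = refl , refl
Graft-injective atRoot     (inLeft g) e = ⊥-elim (m≢1+m+n _ (trans (sym e) (size-≤T (Graft-≤T g))))
Graft-injective (inLeft g) atRoot     e = ⊥-elim (m≢1+m+n _ (trans e (size-≤T (Graft-≤T g))))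
Graft-injective (inLeft g) (inLeft h) e with refl , refl ← Graft-injective g h e = refl , refl

grafts-unique : ∀ s t → Unique (grafts s t)
grafts-unique s leaf         = All.[] ∷ []
grafts-unique s (node t₁ t₂) =
  All.tabulate root∉ ∷ Unique.map⁺ (λ { refl → refl }) (grafts-unique s t₁)
  where
  root∉ : ∀ {X} → X ∈ map (λ Y → node Y t₂) (grafts s t₁) → node s (node t₁ t₂) ≢ X
  root∉ X∈ with _ , _ , refl ← ∈-map⁻ _ X∈ = λ ()

sumMono-grafts : ∀ s t → sumMono leftBranch (grafts s t) ≋ xₚ (mono (leftBranch s) *ₚ divDiff (mono (leftBranch t)))
sumMono-grafts s leaf = ≋-trans (+ₚ-identityʳ _) (xₚ-cong (≋-sym (*ₚ-identityʳ _)))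
sumMono-grafts s (node t₁ t₂) = begin
  mono (suc λs) +ₚ sumMono leftBranch (map (λ X → node X t₂) (grafts s t₁))
    ≡⟨ cong (mono (suc λs) +ₚ_) (sumₚ-map (mono ∘ leftBranch) (λ X → node X t₂) (grafts s t₁)) ⟩
  mono (suc λs) +ₚ sumₚ (xₚ ∘ mono ∘ leftBranch) (grafts s t₁)
    ≈⟨ +ₚ-cong {mono (suc λs)} ≋-refl (xₚ-sumₚ (mono ∘ leftBranch) (grafts s t₁)) ⟨
  xₚ (mono λs) +ₚ xₚ (sumMono leftBranch (grafts s t₁))
    ≈⟨ +ₚ-cong (xₚ-cong (≋-sym (*ₚ-identityʳ (mono λs)))) (xₚ-cong (sumMono-grafts s t₁)) ⟩
  xₚ ((mono λs *ₚ one) +ₚ xₚ (mono λs *ₚ D))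
    ≈⟨ xₚ-cong (+ₚ-cong {mono λs *ₚ one} ≋-refl (*ₚ-xₚ (mono λs) D)) ⟨
  xₚ ((mono λs *ₚ one) +ₚ (mono λs *ₚ xₚ D))
    ≈⟨ xₚ-cong (*ₚ-distribˡ (mono λs) one (xₚ D)) ⟨
  xₚ (mono λs *ₚ (one +ₚ xₚ D))
    ≡⟨ cong (λ q → xₚ (mono λs *ₚ q)) (divDiff-mono (leftBranch t₁)) ⟨
  xₚ (mono λs *ₚ divDiff (mono (suc (leftBranch t₁))))
    ∎
  where
  λs = leftBranch s
  D = divDiff (mono (leftBranch t₁))
  open ≋-Reasoning

GraftBelow : Tree → Tree → Tree → Set
GraftBelow l r X = ∃₂ λ s t → s ≤T l × t ≤T r × Graft s t X

-- A rotation at a node of t's left branch above the graft point becomes a rotation of t.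
GraftBelow-⟶ : ∀ {s t X Y} → X ⟶ Y → Graft s t Y → GraftBelow s t X
GraftBelow-⟶ (rot A B C)    atRoot             = A , node B C , ε , ε , inLeft atRoot
GraftBelow-⟶ (left R L⟶L′)  atRoot             = _ , R , return L⟶L′ , ε , atRoot
GraftBelow-⟶ (right L R⟶R′) atRoot             = L , _ , ε , return R⟶R′ , atRoot
GraftBelow-⟶ (rot _ B C)    (inLeft {t₁} g)    = _ , node (node t₁ B) C , ε , return (rot t₁ B C) , inLeft (inLeft g)
GraftBelow-⟶ (left t₂ X⟶Y)  (inLeft g) with s′ , t₁′ , s′≤s , t₁′≤t₁ , g′ ← GraftBelow-⟶ X⟶Y g =
  s′ , node t₁′ t₂ , s′≤s , node-monoˡ t₂ t₁′≤t₁ , inLeft g′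
GraftBelow-⟶ (right _ R⟶R′) (inLeft {t₁} g)    = _ , node t₁ _ , ε , node-monoʳ t₁ (return R⟶R′) , inLeft g

GraftBelow-≤T : ∀ {l r X Y} → X ≤T Y → GraftBelow l r Y → GraftBelow l r X
GraftBelow-≤T ε         gY = gY
GraftBelow-≤T (X⟶ ◅ ≤Y) gY with s , t , s≤l , t≤r , g ← GraftBelow-≤T ≤Y gY
                            with s′ , t′ , s′≤s , t′≤t , g′ ← GraftBelow-⟶ X⟶ g =
  s′ , t′ , s′≤s ◅◅ s≤l , t′≤t ◅◅ t≤r , g′

-- The lower interval in the Tamari order

below : Tree → List Tree
below leaf       = leaf ∷ []
below (node l r) = concatMap (λ s → concatMap (grafts s) (below r)) (below l)

below-sound : ∀ {T X} → X ∈ below T → X ≤T T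
below-sound {leaf}     (here refl) = ε
below-sound {node l r} X∈
  with s , s∈ , X∈s ← find (∈-concatMap⁻ _ X∈)
  with t , t∈ , X∈st ← find (∈-concatMap⁻ _ X∈s) =
  Graft-≤T (∈-grafts⁻ s t X∈st) ◅◅ node-monoˡ t (below-sound s∈) ◅◅ node-monoʳ l (below-sound t∈)

below-complete : ∀ {T X} → X ≤T T → X ∈ below T
below-complete {leaf}     X≤ = here (size≡0⇒leaf (size-≤T X≤))
below-complete {node l r} X≤ with s , t , s≤l , t≤r , g ← GraftBelow-≤T X≤ (l , r , ε , ε , atRoot) =
  ∈-concatMap⁺ _ (lose (below-complete s≤l) (∈-concatMap⁺ _ (lose (below-complete t≤r) (∈-grafts⁺ g))))

below-unique : ∀ T → Unique (below T)
below-unique leaf       = All.[] ∷ []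
below-unique (node l r) = concatMap-unique _ (below-unique l) inner outer
  where
  inner : ∀ s → Unique (concatMap (grafts s) (below r))
  inner s = concatMap-unique (grafts s) (below-unique r) (grafts-unique s)
    λ _ _ X∈a X∈b → proj₂ (Graft-injective (∈-grafts⁻ s _ X∈a) (∈-grafts⁻ s _ X∈b) refl)
  outer : ∀ {a b X} → a ∈ below l → b ∈ below l →
          X ∈ concatMap (grafts a) (below r) → X ∈ concatMap (grafts b) (below r) → a ≡ b
  outer {a} {b} a∈ b∈ X∈a X∈b
    with t , _ , X∈at ← find (∈-concatMap⁻ (grafts a) {below r} X∈a)
       | t′ , _ , X∈bt′ ← find (∈-concatMap⁻ (grafts b) {below r} X∈b) =
    proj₁ (Graft-injective (∈-grafts⁻ a t X∈at) (∈-grafts⁻ b t′ X∈bt′)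
                           (trans (size-≤T (below-sound {l} a∈)) (sym (size-≤T (below-sound {l} b∈)))))

𝓑≋sumMono-below : ∀ T → 𝓑 T ≋ sumMono leftBranch (below T)
𝓑≋sumMono-below leaf       = ≋-refl
𝓑≋sumMono-below (node l r) = begin
  xₚ (𝓑 l *ₚ divDiff (𝓑 r))
    ≈⟨ xₚ-cong (≋-trans (*ₚ-congʳ _ (𝓑≋sumMono-below l)) (*ₚ-congˡ (sumₚ m (below l)) (divDiff-cong (𝓑≋sumMono-below r)))) ⟩
  xₚ (sumₚ m (below l) *ₚ divDiff (sumₚ m (below r)))
    ≈⟨ xₚ-cong (*ₚ-congˡ (sumₚ m (below l)) (divDiff-sumₚ m (below r))) ⟩
  xₚ (sumₚ m (below l) *ₚ sumₚ (divDiff ∘ m) (below r))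
    ≈⟨ xₚ-cong (sumₚ-*ₚ-sumₚ m (divDiff ∘ m) (below l) (below r)) ⟩
  xₚ (sumₚ (λ s → sumₚ (λ t → m s *ₚ divDiff (m t)) (below r)) (below l))
    ≈⟨ xₚ-sumₚ _ (below l) ⟩
  sumₚ (λ s → xₚ (sumₚ (λ t → m s *ₚ divDiff (m t)) (below r))) (below l)
    ≈⟨ sumₚ-cong (below l) (λ s → xₚ-sumₚ _ (below r)) ⟩
  sumₚ (λ s → sumₚ (λ t → xₚ (m s *ₚ divDiff (m t))) (below r)) (below l)
    ≈⟨ sumₚ-cong (below l) (λ s → sumₚ-cong (below r) (sumMono-grafts s)) ⟨
  sumₚ (λ s → sumₚ (λ t → sumₚ m (grafts s t)) (below r)) (below l)
    ≈⟨ sumₚ-cong (below l) (λ s → sumₚ-concatMap m (grafts s) (below r)) ⟨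
  sumₚ (λ s → sumₚ m (concatMap (grafts s) (below r))) (below l)
    ≈⟨ sumₚ-concatMap m _ (below l) ⟨
  sumₚ m (below (node l r))
    ∎
  where
  m = mono ∘ leftBranch
  open ≋-Reasoning

-- Mirror symmetry

mirror : Tree → Tree
mirror leaf       = leaf
mirror (node l r) = node (mirror r) (mirror l)

mirror-involutive : ∀ T → mirror (mirror T) ≡ T
mirror-involutive leaf       = refl
mirror-involutive (node l r) = cong₂ node (mirror-involutive l) (mirror-involutive r)

mirror-injective : ∀ {X Y} → mirror X ≡ mirror Y → X ≡ Y
mirror-injective {X} {Y} e = begin
  X                  ≡⟨ mirror-involutive X ⟨
  mirror (mirror X)  ≡⟨ cong mirror e ⟩
  mirror (mirror Y)  ≡⟨ mirror-involutive Y ⟩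
  Y                  ∎
  where open ≡-Reasoning

mirror-⟶ : ∀ {X Y} → X ⟶ Y → mirror Y ⟶ mirror X
mirror-⟶ (rot A B C)    = rot (mirror C) (mirror B) (mirror A)
mirror-⟶ (left R L⟶L′)  = right (mirror R) (mirror-⟶ L⟶L′)
mirror-⟶ (right L R⟶R′) = left (mirror L) (mirror-⟶ R⟶R′)

mirror-≤T : ∀ {X Y} → X ≤T Y → mirror Y ≤T mirror X
mirror-≤T ε             = ε
mirror-≤T (X⟶Y ◅ Y≤Z) = mirror-≤T Y≤Z ◅◅ return (mirror-⟶ X⟶Y)

rightBranch-mirror : ∀ T → rightBranch (mirror T) ≡ leftBranch T
rightBranch-mirror leaf       = refl
rightBranch-mirror (node l r) = cong suc (rightBranch-mirror l)

𝓑̃≡𝓑∘mirror : ∀ T → 𝓑̃ T ≡ 𝓑 (mirror T)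
𝓑̃≡𝓑∘mirror leaf       = refl
𝓑̃≡𝓑∘mirror (node l r) = cong₂ (λ p q → xₚ (p *ₚ divDiff q)) (𝓑̃≡𝓑∘mirror r) (𝓑̃≡𝓑∘mirror l)

above : Tree → List Tree
above T = map mirror (below (mirror T))

above-sound : ∀ {T X} → X ∈ above T → T ≤T X
above-sound {T} X∈ with Y , Y∈ , refl ← ∈-map⁻ mirror X∈ =
  subst (_≤T mirror Y) (mirror-involutive T) (mirror-≤T (below-sound Y∈))

above-complete : ∀ {T X} → T ≤T X → X ∈ above T
above-complete {T} {X} T≤X =
  subst (_∈ above T) (mirror-involutive X) (∈-map⁺ mirror (below-complete (mirror-≤T T≤X)))

above-unique : ∀ T → Unique (above T)
above-unique T = Unique.map⁺ mirror-injective (below-unique (mirror T))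

𝓑̃≋sumMono-above : ∀ T → 𝓑̃ T ≋ sumMono rightBranch (above T)
𝓑̃≋sumMono-above T = begin
  𝓑̃ T                                                ≡⟨ 𝓑̃≡𝓑∘mirror T ⟩
  𝓑 (mirror T)                                       ≈⟨ 𝓑≋sumMono-below (mirror T) ⟩
  sumMono leftBranch (below (mirror T))              ≈⟨ sumₚ-cong (below (mirror T)) (≋-reflexive ∘ cong mono ∘ rightBranch-mirror) ⟨
  sumₚ (mono ∘ rightBranch ∘ mirror) (below (mirror T)) ≡⟨ sumₚ-map (mono ∘ rightBranch) mirror (below (mirror T)) ⟨
  sumMono rightBranch (above T)                      ∎
  where open ≋-Reasoning

theorem7p0p6 : ∀ (T : Tree) →
    (Σ (List Tree) λ L →
        Unique L × (∀ T′ → (T′ ∈ L) ⇔ (T′ ≤T T))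
      × (𝓑 T ≈ₚ sumMono leftBranch L) × (at1 (𝓑 T) ≡ length L))
  × (Σ (List Tree) λ L →
        Unique L × (∀ T′ → (T′ ∈ L) ⇔ (T ≤T T′))
      × (𝓑̃ T ≈ₚ sumMono rightBranch L))
theorem7p0p6 T =
  ( below T , below-unique T , (λ _ → mk⇔ below-sound below-complete)
  , coeff-≡ (𝓑≋sumMono-below T)
  , trans (at1-cong (𝓑≋sumMono-below T)) (at1-sumMono leftBranch (below T)) )
  , ( above T , above-unique T , (λ _ → mk⇔ above-sound above-complete)
  , coeff-≡ (𝓑̃≋sumMono-above T) )
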